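{- There exists a function $f(n,w,d)$ such that for all positive integers $n,w,d$ the following holds. Let $G$ be a connected graph with $\Delta(G)\le d$ and let $(T,\mathcal{Y})$ be a lean tree-decomposition of $G$ of width at most $w$. If $|V(G)|\geq f(n,w,d)$, then $T$ contains a path $P$ and vertices $t_1,\dots,t_n$, interior vertices of $P$ occurring along $P$ in this order, such that: (i) for some positive integer $s\leq w+1$, $|Y_{t_i}|=s$ for all $i$, and $|Y_t|\ge s$ for every vertex $t$ of $P$ between $t_1$ and $t_n$; and (ii) there is a set $U\subseteq V(G)$ with $Y_{t_i}\cap Y_{t_j}=U$ for all distinct $i,j$.
   Context: Graphs are finite and loopless but may have multiple edges. A tree-decomposition of $G$ is a pair $(T,\mathcal{Y})$, $T$ a tree, $\mathcal{Y}=\{Y_t\}_{t\in V(T)}$ subsets of $V(G)$, such that (W1) $\bigcup_t Y_t=V(G)$ and every edge has both ends in some $Y_t$; (W2) if $t'$ is on the $T$-path between $t$ and $t''$ then $Y_t\cap Y_{t''}\subseteq Y_{t'}$. Width is $\max_t(|Y_t|-1)$. It is lean if moreover: (W3) for every two vertices $t,t'$ of $T$ and every positive integer $k$, either there are $k$ vertex-disjoint paths in $G$ between $Y_t$ and $Y_{t'}$, or some vertex $t''$ on the $T$-path between $t$ and $t'$ has $|Y_{t''}|<k$; (W4) distinct vertices of $T$ have distinct bags; (W5) for every $t_0\in V(T)$ and every component $B$ of $T-t_0$, $\bigcup_{t\in V(B)}Y_t\setminus Y_{t_0}\neq\emptyset$. -}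

module Defs where

open import Data.Nat using (ℕ; zero; suc; _≤_; _<_)
open import Data.Fin using (Fin; inject₁; toℕ; _≟_) renaming (suc to fsuc)
open import Data.Fin.Subset using (Subset; _∈_; _∉_; _∩_; ∣_∣)
open import Data.List using (List; length; filter)
open import Data.List.Base using ()
open import Data.Fin.Base using ()
open import Data.List using (allFin)
open import Data.Product using (Σ; ∃; ∃-syntax; _×_; _,_; proj₁; proj₂)
open import Data.Sum using (_⊎_)
open import Relation.Nullary using (¬_; Dec)
open import Relation.Nullary.Decidable using (_⊎-dec_)
open import Relation.Binary.PropositionalEquality using (_≡_; _≢_)
open import Function.Definitions using (Injective)

record MultiGraph : Set where
  field
    N     : ℕ
    m     : ℕ
    ends  : Fin m → Fin N × Fin N
    loopless : ∀ e → proj₁ (ends e) ≢ proj₂ (ends e)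

  Adj : Fin N → Fin N → Set
  Adj u v = ∃[ e ] ((ends e ≡ (u , v)) ⊎ (ends e ≡ (v , u)))

  incident? : (v : Fin N) (e : Fin m) → Dec ((proj₁ (ends e) ≡ v) ⊎ (proj₂ (ends e) ≡ v))
  incident? v e = (proj₁ (ends e) ≟ v) ⊎-dec (proj₂ (ends e) ≟ v)

  -- degree = number of edges incident with v (no loops, so each counts once)
  degree : Fin N → ℕ
  degree v = length (filter (incident? v) (allFin m))

record Path {V : Set} (Adj : V → V → Set) : Set where
  field
    len  : ℕ
    vtx  : Fin (suc len) → V
    step : ∀ (i : Fin len) → Adj (vtx (inject₁ i)) (vtx (fsuc i))
    inj  : Injective _≡_ _≡_ vtx

  first : V
  first = vtx Fin.zero

  last : V
  last = vtx (Data.Fin.fromℕ len)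

  _∈P : V → Set
  x ∈P = ∃[ i ] (vtx i ≡ x)

open Path public

PathFromTo : {V : Set} (Adj : V → V → Set) → V → V → Set
PathFromTo Adj a b = Σ (Path Adj) λ P → (first P ≡ a) × (last P ≡ b)

Connected : {V : Set} (Adj : V → V → Set) → Set
Connected {V} Adj = ∀ (a b : V) → PathFromTo Adj a b

HasCycle : {V : Set} (Adj : V → V → Set) → Set
HasCycle Adj = Σ (Path Adj) λ P → (2 ≤ len P) × Adj (last P) (first P)

record IsTree {M : ℕ} (Adj : Fin M → Fin M → Set) : Set where
  field
    nonempty : 1 ≤ M
    sym      : ∀ {s t} → Adj s t → Adj t s
    irrefl   : ∀ {t} → ¬ Adj t t
    connected : Connected Adj
    acyclic  : ¬ HasCycle Adj

-- t' lies on a T-path between t and t'' (endpoints included);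
-- in a tree this path is unique.
OnPathBetween : {M : ℕ} (Adj : Fin M → Fin M → Set) → Fin M → Fin M → Fin M → Set
OnPathBetween Adj t t' t'' = Σ (PathFromTo Adj t t'') λ P → _∈P (proj₁ P) t'

module _ (G : MultiGraph) where
  open MultiGraph G

  record IsTreeDecomposition {M : ℕ} (TAdj : Fin M → Fin M → Set)
                             (Y : Fin M → Subset N) : Set where
    field
      W1-vertices : ∀ v → ∃[ t ] (v ∈ Y t)
      W1-edges    : ∀ e → ∃[ t ] ((proj₁ (ends e) ∈ Y t) × (proj₂ (ends e) ∈ Y t))
      W2 : ∀ t t' t'' → OnPathBetween TAdj t t' t'' → ∀ v → v ∈ Y t → v ∈ Y t'' → v ∈ Y t'

  DisjointPaths : ℕ → Subset N → Subset N → Set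
  DisjointPaths k A B =
    Σ (Fin k → Path Adj) λ Q →
      (∀ i → (first (Q i) ∈ A) × (last (Q i) ∈ B)) ×
      (∀ i j → i ≢ j → ∀ x → _∈P (Q i) x → ¬ (_∈P (Q j) x))

  record IsLeanTreeDecomposition {M : ℕ} (TAdj : Fin M → Fin M → Set)
                                 (Y : Fin M → Subset N) : Set where
    field
      isTD : IsTreeDecomposition TAdj Y
      W3 : ∀ t t' (k : ℕ) → 1 ≤ k →
           DisjointPaths k (Y t) (Y t') ⊎
           (∃[ t'' ] (OnPathBetween TAdj t t'' t' × (∣ Y t'' ∣ < k)))
      W4 : Injective _≡_ _≡_ Y
      -- for every t0 and every component B of T - t0 (namely the component
      -- containing a vertex t1 ≠ t0), the bags of B are not all inside Y t0
      W5 : ∀ t0 t1 → t1 ≢ t0 →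
           ∃[ t ] (Σ (PathFromTo TAdj t1 t) (λ P → ¬ (_∈P (proj₁ P) t0)) ×
                   ∃[ v ] ((v ∈ Y t) × (v ∉ Y t0)))

  MaxDegreeAtMost : ℕ → Set
  MaxDegreeAtMost d = ∀ v → degree v ≤ d

  WidthAtMost : {M : ℕ} → (Fin M → Subset N) → ℕ → Set
  WidthAtMost Y w = ∀ t → ∣ Y t ∣ ≤ suc w

{-# OPTIONS --safe #-}
-- By (W5) the branch of T − u at a neighbour c of u contains a vertex of G outside Y u; a walk
-- of G from it into Y u leaves the branch through an edge that determines c, because by (W2) two
-- branches sharing a vertex outside Y u would close a cycle through u (and if Y u = ∅ every vertex
-- of G lies in every branch, so u has at most one neighbour).  Hence T has maximum degree at most
-- (w + 1) d + 1, and since |V(G)| ≤ (w + 1) |V(T)| a large G forces a long path P in T.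
-- Along P the bag sizes lie in [0, w + 1].  Cut a window of R^(h+1) consecutive bags into R blocks:
-- either every block contains a bag of the minimum size s₀, giving R bags of size s₀ with no
-- smaller bag between them, or some block avoids s₀ and we recurse inside it with minimum s₀ + 1.
-- The common size s is positive since bags are distinct (W4), and the Erdős–Rado sunflower lemma
-- picks n of these R bags with a common pairwise intersection U.

module Submission where

open import Defs

open import Data.Nat
  using (ℕ; zero; suc; _≤_; _<_; _+_; _*_; _^_; _∸_; _≟_; _≤?_; _<?_; z≤n; s≤s; z<s)
open import Function using (id; _∘_)
open import Function.Definitions using (Injective)
open import Data.Nat.Properties
open import Data.Fin as Fin using (Fin; toℕ; fromℕ; inject₁; inject≤; combine)
import Data.Fin.Properties as Fin
open import Data.Fin.Properties using (combine-injective)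
open import Data.Fin.Subset
  using (Subset; Empty; Nonempty; _∈_; _∉_; _⊆_; _∩_; _∪_; ⁅_⁆; ∣_∣; inside; outside)
  renaming (⊥ to ∅)
open import Data.Fin.Subset.Properties
  using (_∈?_; _⊆?_; nonempty?; ∉⊥; ∣⊥∣≡0; ⊆-antisym; p⊆q⇒∣p∣≤∣q∣; p⊂q⇒∣p∣<∣q∣;
         ∩-comm; ∩-idem; x∈p∩q⁺; x∈p∩q⁻; p⊆p∪q; x∈p∪q⁺; x∈p∪q⁻; x∈⁅x⁆; x∈⁅y⁆⇒x≡y)
open import Data.Vec using ([]; _∷_; here; there)
open import Data.List using (List; []; _∷_; _++_; length; map; lookup; concatMap; filter; allFin)
open import Data.List.Properties using (length-map; length-++)
open import Data.List.Membership.Propositional using (lose; find) renaming (_∈_ to _∈ˡ_)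
open import Data.List.Membership.Propositional.Properties
  using (∈-map⁺; ∈-lookup; ∈-++⁺ˡ; ∈-++⁺ʳ; ∈-filter⁺; ∈-allFin)
open import Data.List.Membership.Setoid.Properties using (index-injective)
open import Data.List.Relation.Unary.All as All using (All; []; _∷_)
open import Data.List.Relation.Unary.All.Properties using (¬All⇒Any¬)
open import Data.List.Relation.Unary.AllPairs using (AllPairs; []; _∷_)
open import Data.List.Relation.Unary.Any using (Any; here; there)
import Data.List.Relation.Unary.Any as Any
import Data.List.Relation.Unary.Any.Properties as Any
open import Data.List.Relation.Binary.Sublist.Propositional
  using ([]; _∷_; _∷ʳ_) renaming (_⊆_ to _⊑_; ⊆-refl to ⊑-refl; ⊆-trans to ⊑-trans)
open import Data.List.Relation.Binary.Sublist.Propositional.Properties using (All-resp-⊆; Any-resp-⊆)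
open import Data.Product using (Σ; ∃; ∃₂; ∃-syntax; _×_; _,_; proj₁; proj₂)
open import Data.Sum using (_⊎_; inj₁; inj₂)
import Data.Sum as Sum
open import Data.Unit using (⊤; tt)
open import Data.Empty using (⊥-elim)
open import Relation.Nullary using (¬_; Dec; yes; no; contradiction; ¬?)
open import Relation.Unary using (Decidable)
open import Relation.Nullary.Decidable using (_×-dec_; _⊎-dec_; decidable-stable)
open import Relation.Binary.Definitions using (DecidableEquality; tri<; tri≈; tri>)
open import Relation.Binary.PropositionalEquality
  using (_≡_; _≢_; refl; sym; trans; cong; cong₂; subst; subst₂; setoid; module ≡-Reasoning)

AllPairs-resp-⊑ : ∀ {A : Set} {R : A → A → Set} {xs ys : List A} →
                  xs ⊑ ys → AllPairs R ys → AllPairs R xs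
AllPairs-resp-⊑ []         []         = []
AllPairs-resp-⊑ (_ ∷ʳ τ)   (_ ∷ rys)  = AllPairs-resp-⊑ τ rys
AllPairs-resp-⊑ (refl ∷ τ) (ry ∷ rys) = All-resp-⊆ τ ry ∷ AllPairs-resp-⊑ τ rys

AllPairs-lookup : ∀ {A : Set} {R : A → A → Set} {xs : List A} → AllPairs R xs →
                  ∀ {i j} → i Fin.< j → R (lookup xs i) (lookup xs j)
AllPairs-lookup (rx ∷ _)  {Fin.zero}  {Fin.suc j} _   = All.lookup rx (∈-lookup j)
AllPairs-lookup (_ ∷ rxs) {Fin.suc i} {Fin.suc j} i<j = AllPairs-lookup rxs (≤-pred i<j)

module _ {A : Set} {n : ℕ} (xs : List A) (n≤∣xs∣ : n ≤ length xs) where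

  select : Fin n → A
  select i = lookup xs (inject≤ i n≤∣xs∣)

  select-∈ : ∀ i → select i ∈ˡ xs
  select-∈ i = ∈-lookup (inject≤ i n≤∣xs∣)

  AllPairs-select : ∀ {R : A → A → Set} → AllPairs R xs →
                    ∀ {i j} → i Fin.< j → R (select i) (select j)
  AllPairs-select pairs {i} {j} i<j = AllPairs-lookup pairs
    (subst₂ _<_ (sym (Fin.toℕ-inject≤ i n≤∣xs∣)) (sym (Fin.toℕ-inject≤ j n≤∣xs∣)) i<j)

module _ {A : Set} {n : ℕ} {xs : List A} where

  indexIn : ∀ {x} → .(length xs ≤ n) → x ∈ˡ xs → Fin n
  indexIn ∣xs∣≤n x∈xs = inject≤ (Any.index x∈xs) ∣xs∣≤n

  indexIn-injective : ∀ {x y} .(∣xs∣≤n : length xs ≤ n) (x∈xs : x ∈ˡ xs) (y∈xs : y ∈ˡ xs) →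
                      indexIn ∣xs∣≤n x∈xs ≡ indexIn ∣xs∣≤n y∈xs → x ≡ y
  indexIn-injective ∣xs∣≤n x∈xs y∈xs eq =
    index-injective (setoid A) x∈xs y∈xs (Fin.inject≤-injective ∣xs∣≤n ∣xs∣≤n _ _ eq)

module _ {A B : Set} (R : B → A → Set) where

  private
    Covered : List B → A → Set
    Covered ys x = Any (λ y → R y x) ys

  split-Any : ∀ {y ys xs} → All (Covered (y ∷ ys)) xs →
    ∃₂ λ us vs → us ⊑ xs × vs ⊑ xs × length us + length vs ≡ length xs ×
                 All (R y) us × All (Covered ys) vs
  split-Any [] = [] , [] , [] , [] , refl , [] , []
  split-Any (here r ∷ cs) with split-Any cs
  ... | us , vs , τ , τ′ , eq , rs , cs′ =
    _ ∷ us , vs , refl ∷ τ , _ ∷ʳ τ′ , cong suc eq , r ∷ rs , cs′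
  split-Any (there c ∷ cs) with split-Any cs
  ... | us , vs , τ , τ′ , eq , rs , cs′ =
    us , _ ∷ vs , _ ∷ʳ τ , refl ∷ τ′ , trans (+-suc _ _) (cong suc eq) , rs , c ∷ cs′

  pigeonhole-Any : ∀ ys {xs} q → All (Covered ys) xs → length ys * q < length xs →
                   ∃₂ λ y zs → zs ⊑ xs × q < length zs × All (R y) zs
  pigeonhole-Any []       q (() ∷ _) _
  pigeonhole-Any (y ∷ ys) q cs big with split-Any cs
  ... | us , vs , τ , τ′ , eq , rs , cs′ with q <? length us
  ...   | yes q<us = y , us , τ , q<us , rs
  ...   | no  q≮us =
    let z , zs , σ , q<zs , rz = pigeonhole-Any ys q cs′ (+-cancelˡ-< q _ _ rest-large)
    in z , zs , ⊑-trans σ τ′ , q<zs , rz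
    where
      rest-large : q + length ys * q < q + length vs
      rest-large = begin-strict
        q + length ys * q      <⟨ big ⟩
        _                      ≡⟨ eq ⟨
        length us + length vs  ≤⟨ +-monoˡ-≤ (length vs) (≮⇒≥ q≮us) ⟩
        q + length vs          ∎
        where open ≤-Reasoning

elements : ∀ {n} → Subset n → List (Fin n)
elements []            = []
elements (inside ∷ p)  = Fin.zero ∷ map Fin.suc (elements p)
elements (outside ∷ p) = map Fin.suc (elements p)

length-elements : ∀ {n} (p : Subset n) → length (elements p) ≡ ∣ p ∣
length-elements []            = refl
length-elements (inside ∷ p)  = cong suc (trans (length-map Fin.suc (elements p)) (length-elements p))
length-elements (outside ∷ p) = trans (length-map Fin.suc (elements p)) (length-elements p)

∈-elements : ∀ {n} {x : Fin n} {p : Subset n} → x ∈ p → x ∈ˡ elements p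
∈-elements {p = inside ∷ _}  here        = here refl
∈-elements {p = inside ∷ _}  (there x∈p) = there (∈-map⁺ Fin.suc (∈-elements x∈p))
∈-elements {p = outside ∷ _} (there x∈p) = ∈-map⁺ Fin.suc (∈-elements x∈p)

⊆-or-∉ : ∀ {n} (p q : Subset n) → p ⊆ q ⊎ ∃ λ x → x ∈ p × x ∉ q
⊆-or-∉ p q with Fin.any? (λ x → x ∈? p ×-dec ¬? (x ∈? q))
... | yes x∈p∖q = inj₂ x∈p∖q
... | no  ¬x∈p∖q = inj₁ λ {x} x∈p →
  decidable-stable (x ∈? q) λ x∉q → ¬x∈p∖q (x , x∈p , x∉q)

p⊆q⇒∣q∣≤∣p∣⇒p≡q : ∀ {n} {p q : Subset n} → p ⊆ q → ∣ q ∣ ≤ ∣ p ∣ → p ≡ q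
p⊆q⇒∣q∣≤∣p∣⇒p≡q {p = p} {q} p⊆q ∣q∣≤∣p∣ with ⊆-or-∉ q p
... | inj₁ q⊆p = ⊆-antisym p⊆q q⊆p
... | inj₂ (x , x∈q , x∉p) =
  contradiction (p⊂q⇒∣p∣<∣q∣ (p⊆q , x , x∈q , x∉p)) (≤⇒≯ ∣q∣≤∣p∣)

∣p∣<∣q∣⇒∃∉ : ∀ {n} {p q : Subset n} → ∣ p ∣ < ∣ q ∣ → ∃ λ x → x ∈ q × x ∉ p
∣p∣<∣q∣⇒∃∉ {p = p} {q} ∣p∣<∣q∣ with ⊆-or-∉ q p
... | inj₁ q⊆p   = contradiction (p⊆q⇒∣p∣≤∣q∣ q⊆p) (<⇒≱ ∣p∣<∣q∣)
... | inj₂ x∈q∖p = x∈q∖p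

∪-⁅⁆-⊆ : ∀ {n} {C p : Subset n} {y} → C ⊆ p → y ∈ p → C ∪ ⁅ y ⁆ ⊆ p
∪-⁅⁆-⊆ {C = C} {y = y} C⊆p y∈p x∈C∪y with x∈p∪q⁻ C ⁅ y ⁆ x∈C∪y
... | inj₁ x∈C = C⊆p x∈C
... | inj₂ x∈⁅y⁆ = subst (_∈ _) (sym (x∈⁅y⁆⇒x≡y y x∈⁅y⁆)) y∈p

∣p∣≡0⇒p≡∅ : ∀ {n} {p : Subset n} → ∣ p ∣ ≡ 0 → p ≡ ∅
∣p∣≡0⇒p≡∅ {n} ∣p∣≡0 =
  sym (p⊆q⇒∣q∣≤∣p∣⇒p≡q (λ x∈∅ → contradiction x∈∅ ∉⊥) (≤-reflexive (trans ∣p∣≡0 (sym (∣⊥∣≡0 n)))))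

-- Plateaus in a sequence of numbers

module _ {P : ℕ → Set} (P? : Decidable P) where

  search-range : ∀ b B → (∃ λ k → b ≤ k × k < b + B × P k) ⊎
                         (∀ {k} → b ≤ k → k < b + B → ¬ P k)
  search-range b B with anyUpTo? (λ i → P? (b + i)) B
  ... | yes (i , i<B , Pb+i) = inj₁ (b + i , m≤m+n b i , +-monoʳ-< b i<B , Pb+i)
  ... | no ¬∃ = inj₂ λ {k} b≤k k<b+B Pk →
    ¬∃ (k ∸ b , subst (k ∸ b <_) (m+n∸m≡n b B) (∸-monoˡ-< k<b+B b≤k) ,
        subst P (sym (m+[n∸m]≡n b≤k)) Pk)

InWindow : ℕ → ℕ → ℕ → Set
InWindow a b p = a ≤ p × p < b

InWindow-mono : ∀ {a a′ b b′ p} → a ≤ a′ → b′ ≤ b → InWindow a′ b′ p → InWindow a b p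
InWindow-mono a≤a′ b′≤b (a′≤p , p<b′) = ≤-trans a≤a′ a′≤p , <-≤-trans p<b′ b′≤b

module Plateaus (σ : ℕ → ℕ) where

  record Plateau (s a b : ℕ) (ps : List ℕ) : Set where
    field
      sorted  : AllPairs _<_ ps
      within  : All (InWindow a b) ps
      level   : All (λ p → σ p ≡ s) ps
      between : ∀ {p q k} → p ∈ˡ ps → q ∈ˡ ps → p ≤ k → k ≤ q → s ≤ σ k

  Plateau-⊑ : ∀ {s a b ps qs} → qs ⊑ ps → Plateau s a b ps → Plateau s a b qs
  Plateau-⊑ τ pl = record
    { sorted  = AllPairs-resp-⊑ τ sorted
    ; within  = All-resp-⊆ τ within
    ; level   = All-resp-⊆ τ level
    ; between = λ p∈ q∈ → between (Any-resp-⊆ τ p∈) (Any-resp-⊆ τ q∈)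
    }
    where open Plateau pl

  Plateau-widen : ∀ {s a a′ b b′ ps} → a ≤ a′ → b′ ≤ b → Plateau s a′ b′ ps → Plateau s a b ps
  Plateau-widen a≤a′ b′≤b pl = record
    { sorted  = sorted
    ; within  = All.map (InWindow-mono a≤a′ b′≤b) within
    ; level   = level
    ; between = between
    }
    where open Plateau pl

  Occurrences : ℕ → ℕ → ℕ → ℕ → Set
  Occurrences j s a b =
    ∃ λ ps → j ≤ length ps × AllPairs _<_ ps × All (InWindow a b) ps × All (λ p → σ p ≡ s) ps

  Gap : ℕ → ℕ → ℕ → ℕ → Set
  Gap s B a b = ∃ λ b′ → a ≤ b′ × b′ + B ≤ b × ∀ {k} → InWindow b′ (b′ + B) k → σ k ≢ s

  floor-plateau : ∀ {j s a b} → (∀ {k} → InWindow a b k → s ≤ σ k) → Occurrences j s a b →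
                  ∃ λ ps → j ≤ length ps × Plateau s a b ps
  floor-plateau floor (ps , j≤ , sorted , within , level) = ps , j≤ , record
    { sorted  = sorted
    ; within  = within
    ; level   = level
    ; between = λ p∈ q∈ p≤k k≤q →
        floor (≤-trans (proj₁ (All.lookup within p∈)) p≤k , ≤-<-trans k≤q (proj₂ (All.lookup within q∈)))
    }

  scan : ∀ s B j b → Gap s B b (b + j * B) ⊎ Occurrences j s b (b + j * B)
  scan s B zero    b = inj₂ ([] , z≤n , [] , [] , [])
  scan s B (suc j) b with search-range (λ k → σ k ≟ s) b B | scan s B j (b + B)
  ... | inj₂ none | _ = inj₁ (b , ≤-refl , first-block , λ (b≤k , k<b+B) → none b≤k k<b+B)
    where first-block = +-monoʳ-≤ b (m≤m+n B (j * B))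
  ... | inj₁ _ | inj₁ (b′ , b+B≤b′ , b′+B≤ , none) =
    inj₁ (b′ , ≤-trans (m≤m+n b B) b+B≤b′ , ≤-trans b′+B≤ (≤-reflexive (+-assoc b B (j * B))) , none)
  ... | inj₁ (k , b≤k , k<b+B , σk≡s) | inj₂ (ps , j≤ , sorted , within , level) =
    inj₂ (k ∷ ps , s≤s j≤ , All.map (λ w → <-≤-trans k<b+B (proj₁ w)) within ∷ sorted ,
          (b≤k , <-≤-trans k<b+B first-block) ∷ All.map (InWindow-mono (m≤m+n b B) later-blocks) within ,
          σk≡s ∷ level)
    where first-block = +-monoʳ-≤ b (m≤m+n B (j * B))
          later-blocks = ≤-reflexive (+-assoc b B (j * B))

  plateau : ∀ R h s₀ a → (∀ {k} → InWindow a (a + R ^ suc h) k → s₀ ≤ σ k × σ k ≤ s₀ + h) →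
            ∃₂ λ s ps → s₀ ≤ s × s ≤ s₀ + h × R ≤ length ps × Plateau s a (a + R ^ suc h) ps
  plateau R h s₀ a bounds with scan s₀ (R ^ h) R a
  ... | inj₂ occurrences =
    let ps , R≤ , pl = floor-plateau (proj₁ ∘ bounds) occurrences in s₀ , ps , ≤-refl , m≤m+n s₀ h , R≤ , pl
  plateau R zero s₀ a bounds | inj₁ (b , a≤b , b+1≤ , gap) =
    contradiction (≤-antisym (≤-trans σb≤s₀+0 (≤-reflexive (+-identityʳ s₀))) s₀≤σb) (gap (≤-refl , b<b+1))
    where
      b<b+1 = m<m+n b z<s
      s₀≤σb = proj₁ (bounds (a≤b , <-≤-trans b<b+1 b+1≤))
      σb≤s₀+0 = proj₂ (bounds (a≤b , <-≤-trans b<b+1 b+1≤))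
  plateau R (suc h) s₀ a bounds | inj₁ (b , a≤b , b+B≤ , gap) =
    let s , ps , s₀<s , s≤ , R≤ , pl = plateau R h (suc s₀) b raised
    in s , ps , <⇒≤ s₀<s , ≤-trans s≤ (≤-reflexive (sym (+-suc s₀ h))) , R≤ , Plateau-widen a≤b b+B≤ pl
    where
      raised : ∀ {k} → InWindow b (b + R ^ suc h) k → suc s₀ ≤ σ k × σ k ≤ suc s₀ + h
      raised k∈ with bounds (InWindow-mono a≤b b+B≤ k∈)
      ... | s₀≤σk , σk≤ = ≤∧≢⇒< s₀≤σk (gap k∈ ∘ sym) , ≤-trans σk≤ (≤-reflexive (+-suc s₀ h))

-- The sunflower lemma

-- sunflowerBound n S (k + 1) exceeds n S · sunflowerBound n S k: a maximal family with kernel C and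
-- fewer than n members has fewer than n S points, every set meets them outside C, and by pigeonhole
-- one of these points lies in more than sunflowerBound n S k sets.
sunflowerBound : (n S k : ℕ) → ℕ
sunflowerBound n S zero    = n
sunflowerBound n S (suc k) = suc (sunflowerBound n S k + n * S * sunflowerBound n S k)

n≤sunflowerBound : ∀ n S k → n ≤ sunflowerBound n S k
n≤sunflowerBound n S zero    = ≤-refl
n≤sunflowerBound n S (suc k) = m≤n⇒m≤1+n (≤-trans (n≤sunflowerBound n S k) (m≤m+n _ _))

module Sunflowers {A : Set} {N : ℕ} (F : A → Subset N) (n S : ℕ) where

  Kernel : Subset N → List A → Set
  Kernel U = AllPairs (λ p q → F p ∩ F q ≡ U)

  Sunflower : List A → Set
  Sunflower xs = ∃₂ λ qs U → qs ⊑ xs × n ≤ length qs × Kernel U qs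

  Sunflower-⊑ : ∀ {xs ys} → ys ⊑ xs → Sunflower ys → Sunflower xs
  Sunflower-⊑ τ (qs , U , σ , n≤qs , kernel) = qs , U , ⊑-trans σ τ , n≤qs , kernel

  points : List A → List (Fin N)
  points = concatMap (elements ∘ F)

  length-points : ∀ {s} qs → All (λ q → ∣ F q ∣ ≡ s) qs → length (points qs) ≡ length qs * s
  length-points []       []            = refl
  length-points (q ∷ qs) (∣q∣≡s ∷ ∣qs∣≡s) = begin
    length (elements (F q) ++ points qs)          ≡⟨ length-++ (elements (F q)) ⟩
    length (elements (F q)) + length (points qs)  ≡⟨ cong₂ _+_ ∣elements∣≡s (length-points qs ∣qs∣≡s) ⟩
    _ + length qs * _                             ∎
    where
      open ≡-Reasoning
      ∣elements∣≡s = trans (length-elements (F q)) ∣q∣≡s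

  ∈-points : ∀ {q qs y} → q ∈ˡ qs → y ∈ F q → y ∈ˡ points qs
  ∈-points (here refl) y∈q = ∈-++⁺ˡ (∈-elements y∈q)
  ∈-points {qs = q′ ∷ _} (there q∈qs) y∈q = ∈-++⁺ʳ (elements (F q′)) (∈-points q∈qs y∈q)

  Hits : Subset N → List A → A → Set
  Hits C qs p = Any (λ y → y ∉ C × y ∈ F p) (points qs)

  kernel-of-equal : ∀ {C xs} → All (λ p → F p ≡ C) xs → Kernel C xs
  kernel-of-equal []             = []
  kernel-of-equal (p≡C ∷ xs≡C) =
    All.map (λ q≡C → trans (cong₂ _∩_ p≡C q≡C) (∩-idem _)) xs≡C ∷ kernel-of-equal xs≡C

  maximal-kernel : ∀ C xs → All (λ p → C ⊆ F p) xs → All (λ p → ∃ λ y → y ∈ F p × y ∉ C) xs →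
                   ∃ λ qs → qs ⊑ xs × Kernel C qs × All (Hits C qs) xs
  maximal-kernel C []       _            _                            = [] , [] , [] , []
  maximal-kernel C (x ∷ xs) (C⊆x ∷ C⊆xs) ((y , y∈x , y∉C) ∷ escapes)
    with maximal-kernel C xs C⊆xs escapes
  ... | qs , τ , kernel , hits with All.all? (λ q → (F x ∩ F q) ⊆? C) qs
  ...   | yes meets = x ∷ qs , refl ∷ τ , All.zipWith exact (meets , All-resp-⊆ τ C⊆xs) ∷ kernel ,
                      Any.++⁺ˡ (lose (∈-elements y∈x) (y∉C , y∈x)) ∷ All.map (Any.++⁺ʳ (elements (F x))) hits
    where
      exact : ∀ {q} → (F x ∩ F q) ⊆ C × C ⊆ F q → F x ∩ F q ≡ C
      exact (x∩q⊆C , C⊆q) = ⊆-antisym x∩q⊆C (λ z∈C → x∈p∩q⁺ (C⊆x z∈C , C⊆q z∈C))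
  ...   | no ¬meets with find (¬All⇒Any¬ (λ q → (F x ∩ F q) ⊆? C) qs ¬meets)
  ...     | q , q∈qs , x∩q⊈C with ⊆-or-∉ (F x ∩ F q) C
  ...       | inj₁ x∩q⊆C = ⊥-elim (x∩q⊈C x∩q⊆C)
  ...       | inj₂ (z , z∈x∩q , z∉C) with x∈p∩q⁻ (F x) (F q) z∈x∩q
  ...         | z∈x , z∈q = qs , x ∷ʳ τ , kernel , lose (∈-points q∈qs z∈q) (z∉C , z∈x) ∷ hits

  kernel-or-popular-point : ∀ {s} k C xs → s ≤ S → ∣ C ∣ < s → sunflowerBound n S (suc k) ≤ length xs →
    All (λ p → C ⊆ F p) xs → All (λ p → ∣ F p ∣ ≡ s) xs →
    Sunflower xs ⊎ ∃₂ λ y zs → y ∉ C × zs ⊑ xs × sunflowerBound n S k < length zs × All (λ p → y ∈ F p) zs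
  kernel-or-popular-point {s} k C xs s≤S ∣C∣<s big C⊆ sizes
    with maximal-kernel C xs C⊆ (All.map (λ ∣p∣≡s → ∣p∣<∣q∣⇒∃∉ (subst (∣ C ∣ <_) (sym ∣p∣≡s) ∣C∣<s)) sizes)
  ... | qs , τ , kernel , hits with n ≤? length qs
  ...   | yes n≤qs = inj₁ (qs , C , τ , n≤qs , kernel)
  ...   | no  n≰qs = inj₂ (popular (pigeonhole-Any _ (points qs) Φk hits few-points))
    where
      Φk = sunflowerBound n S k

      few-points : length (points qs) * Φk < length xs
      few-points = begin-strict
        length (points qs) * Φk     ≡⟨ cong (_* Φk) (length-points qs (All-resp-⊆ τ sizes)) ⟩
        length qs * s * Φk          ≤⟨ *-monoˡ-≤ Φk (*-mono-≤ (<⇒≤ (≰⇒> n≰qs)) s≤S) ⟩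
        n * S * Φk                  <⟨ s≤s (m≤n+m _ _) ⟩
        sunflowerBound n S (suc k)  ≤⟨ big ⟩
        length xs                   ∎
        where open ≤-Reasoning

      popular : (∃₂ λ y zs → zs ⊑ xs × Φk < length zs × All (λ p → y ∉ C × y ∈ F p) zs) →
                ∃₂ λ y zs → y ∉ C × zs ⊑ xs × Φk < length zs × All (λ p → y ∈ F p) zs
      popular (y , z ∷ zs , τ′ , Φk<zs , y∈zs@((y∉C , _) ∷ _)) =
        y , z ∷ zs , y∉C , τ′ , Φk<zs , All.map proj₂ y∈zs

  sunflower-with-kernel : ∀ {s} k C xs → s ≤ S → s ≤ ∣ C ∣ + k → sunflowerBound n S k ≤ length xs →
                          All (λ p → C ⊆ F p) xs → All (λ p → ∣ F p ∣ ≡ s) xs → Sunflower xs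
  sunflower-with-kernel {s} k C xs s≤S s≤C+k big C⊆ sizes with s ≤? ∣ C ∣
  ... | yes s≤C = xs , C , ⊑-refl , ≤-trans (n≤sunflowerBound n S k) big ,
                  kernel-of-equal (All.zipWith is-kernel (C⊆ , sizes))
    where
      is-kernel : ∀ {p} → C ⊆ F p × ∣ F p ∣ ≡ s → F p ≡ C
      is-kernel (C⊆p , ∣p∣≡s) = sym (p⊆q⇒∣q∣≤∣p∣⇒p≡q C⊆p (≤-trans (≤-reflexive ∣p∣≡s) s≤C))
  sunflower-with-kernel zero C xs s≤S s≤C+0 _ _ _ | no s≰C =
    contradiction (≤-trans s≤C+0 (≤-reflexive (+-identityʳ _))) s≰C
  sunflower-with-kernel {s} (suc k) C xs s≤S s≤C+k big C⊆ sizes | no s≰C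
    with kernel-or-popular-point k C xs s≤S (≰⇒> s≰C) big C⊆ sizes
  ... | inj₁ found = found
  ... | inj₂ (y , zs , y∉C , τ , Φk<zs , y∈zs) =
    Sunflower-⊑ τ (sunflower-with-kernel k (C ∪ ⁅ y ⁆) zs s≤S s≤∣C∪y∣+k (<⇒≤ Φk<zs)
                     (All.zipWith grow (All-resp-⊆ τ C⊆ , y∈zs)) (All-resp-⊆ τ sizes))
    where
      grow : ∀ {p} → C ⊆ F p × y ∈ F p → C ∪ ⁅ y ⁆ ⊆ F p
      grow (C⊆p , y∈p) = ∪-⁅⁆-⊆ C⊆p y∈p
      s≤∣C∪y∣+k : s ≤ ∣ C ∪ ⁅ y ⁆ ∣ + k
      s≤∣C∪y∣+k = ≤-trans s≤C+k (≤-trans (≤-reflexive (+-suc ∣ C ∣ k))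
                    (+-monoˡ-≤ k (p⊂q⇒∣p∣<∣q∣ (p⊆p∪q ⁅ y ⁆ , y , x∈p∪q⁺ (inj₂ (x∈⁅x⁆ y)) , y∉C))))

  sunflower : ∀ {s} xs → s ≤ S → sunflowerBound n S S ≤ length xs →
              All (λ p → ∣ F p ∣ ≡ s) xs → Sunflower xs
  sunflower {s} xs s≤S big sizes =
    sunflower-with-kernel S ∅ xs s≤S (subst (λ c → s ≤ c + S) (sym (∣⊥∣≡0 N)) s≤S) big
      (All.universal ∅⊆ xs) sizes
    where
      ∅⊆ : ∀ p → ∅ ⊆ F p
      ∅⊆ _ x∈∅ = contradiction x∈∅ ∉⊥

-- Walks

module Walks {V : Set} (E : V → V → Set) where

  infixr 5 _∷⟨_⟩_
  data Walk : V → V → Set where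
    [_]    : (a : V) → Walk a a
    _∷⟨_⟩_ : (a : V) {b c : V} → E a b → Walk b c → Walk a c

  steps : ∀ {a b} → Walk a b → ℕ
  steps [ _ ]        = 0
  steps (_ ∷⟨ _ ⟩ w) = suc (steps w)

  infix 4 _∈ʷ_ _∉ʷ_
  _∈ʷ_ : ∀ {a b} → V → Walk a b → Set
  x ∈ʷ [ a ]        = x ≡ a
  x ∈ʷ (a ∷⟨ _ ⟩ w) = x ≡ a ⊎ x ∈ʷ w

  _∉ʷ_ : ∀ {a b} → V → Walk a b → Set
  x ∉ʷ w = ¬ x ∈ʷ w

  start∈ʷ : ∀ {a b} (w : Walk a b) → a ∈ʷ w
  start∈ʷ [ _ ]        = refl
  start∈ʷ (_ ∷⟨ _ ⟩ _) = inj₁ refl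

  infixr 5 _++ʷ_
  _++ʷ_ : ∀ {a b c} → Walk a b → Walk b c → Walk a c
  [ _ ]        ++ʷ w′ = w′
  (a ∷⟨ e ⟩ w) ++ʷ w′ = a ∷⟨ e ⟩ (w ++ʷ w′)

  ∈-++ʷ⁻ : ∀ {a b c x} (w : Walk a b) {w′ : Walk b c} → x ∈ʷ w ++ʷ w′ → x ∈ʷ w ⊎ x ∈ʷ w′
  ∈-++ʷ⁻ [ _ ]        x∈w′        = inj₂ x∈w′
  ∈-++ʷ⁻ (_ ∷⟨ _ ⟩ _) (inj₁ x≡a)  = inj₁ (inj₁ x≡a)
  ∈-++ʷ⁻ (_ ∷⟨ _ ⟩ w) (inj₂ x∈)   = Sum.map₁ inj₂ (∈-++ʷ⁻ w x∈)

  ∉-++ʷ : ∀ {a b c x} (w : Walk a b) {w′ : Walk b c} → x ∉ʷ w → x ∉ʷ w′ → x ∉ʷ w ++ʷ w′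
  ∉-++ʷ w x∉w x∉w′ x∈ = Sum.[ x∉w , x∉w′ ] (∈-++ʷ⁻ w x∈)

  module _ (E-sym : ∀ {a b} → E a b → E b a) where

    reverse : ∀ {a b} → Walk a b → Walk b a
    reverse [ a ]        = [ a ]
    reverse (a ∷⟨ e ⟩ w) = reverse w ++ʷ (_ ∷⟨ E-sym e ⟩ [ a ])

    ∈-reverse⁻ : ∀ {a b x} (w : Walk a b) → x ∈ʷ reverse w → x ∈ʷ w
    ∈-reverse⁻ [ _ ]        x∈ = x∈
    ∈-reverse⁻ (_ ∷⟨ _ ⟩ w) x∈ with ∈-++ʷ⁻ (reverse w) x∈
    ... | inj₁ x∈w         = inj₂ (∈-reverse⁻ w x∈w)
    ... | inj₂ (inj₁ refl) = inj₂ (start∈ʷ w)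
    ... | inj₂ (inj₂ x≡a)  = inj₁ x≡a

  1≤steps : ∀ {a b} (w : Walk a b) → a ≢ b → 1 ≤ steps w
  1≤steps [ _ ]        a≢a = contradiction refl a≢a
  1≤steps (_ ∷⟨ _ ⟩ _) _   = s≤s z≤n

  Simple : ∀ {a b} → Walk a b → Set
  Simple [ _ ]        = ⊤
  Simple (a ∷⟨ _ ⟩ w) = a ∉ʷ w × Simple w

  _⊆ʷ_ : ∀ {a b a′ b′} → Walk a b → Walk a′ b′ → Set
  w ⊆ʷ w′ = ∀ {x} → x ∈ʷ w → x ∈ʷ w′

  module _ (_≟_ : DecidableEquality V) where

    _∈ʷ?_ : ∀ {a b} x (w : Walk a b) → Dec (x ∈ʷ w)
    x ∈ʷ? [ a ]        = x ≟ a
    x ∈ʷ? (a ∷⟨ _ ⟩ w) = x ≟ a ⊎-dec x ∈ʷ? w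

    suffixFrom : ∀ {a b} x (w : Walk a b) → x ∈ʷ w →
                 Σ (Walk x b) λ w′ → (Simple w → Simple w′) × w′ ⊆ʷ w
    suffixFrom _ [ a ]        refl       = [ a ] , id , id
    suffixFrom _ (a ∷⟨ e ⟩ w) (inj₁ refl) = a ∷⟨ e ⟩ w , id , id
    suffixFrom x (a ∷⟨ e ⟩ w) (inj₂ x∈w) =
      let w′ , simple , w′⊆w = suffixFrom x w x∈w
      in w′ , simple ∘ proj₂ , λ x∈w′ → inj₂ (w′⊆w x∈w′)

    simplify : ∀ {a b} (w : Walk a b) → Σ (Walk a b) λ w′ → Simple w′ × w′ ⊆ʷ w
    simplify [ a ] = [ a ] , tt , id
    simplify (a ∷⟨ e ⟩ w) with simplify w
    ... | w′ , simple , w′⊆w with a ∈ʷ? w′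
    ...   | yes a∈w′ = let w″ , simple′ , w″⊆w′ = suffixFrom a w′ a∈w′
                       in w″ , simple′ simple , λ x∈w″ → inj₂ (w′⊆w (w″⊆w′ x∈w″))
    ...   | no  a∉w′ = a ∷⟨ e ⟩ w′ , (a∉w′ , simple) , Sum.map₂ w′⊆w

  vertex : ∀ {a b} (w : Walk a b) → Fin (suc (steps w)) → V
  vertex [ a ]        _           = a
  vertex (a ∷⟨ _ ⟩ _) Fin.zero    = a
  vertex (_ ∷⟨ _ ⟩ w) (Fin.suc i) = vertex w i

  vertex-zero : ∀ {a b} (w : Walk a b) → vertex w Fin.zero ≡ a
  vertex-zero [ _ ]        = refl
  vertex-zero (_ ∷⟨ _ ⟩ _) = refl

  vertex-last : ∀ {a b} (w : Walk a b) → vertex w (fromℕ (steps w)) ≡ b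
  vertex-last [ _ ]        = refl
  vertex-last (_ ∷⟨ _ ⟩ w) = vertex-last w

  vertex-∈ʷ : ∀ {a b} (w : Walk a b) i → vertex w i ∈ʷ w
  vertex-∈ʷ [ _ ]        Fin.zero    = refl
  vertex-∈ʷ (_ ∷⟨ _ ⟩ _) Fin.zero    = inj₁ refl
  vertex-∈ʷ (_ ∷⟨ _ ⟩ w) (Fin.suc i) = inj₂ (vertex-∈ʷ w i)

  vertex-step : ∀ {a b} (w : Walk a b) (i : Fin (steps w)) →
                E (vertex w (inject₁ i)) (vertex w (Fin.suc i))
  vertex-step (a ∷⟨ e ⟩ w) Fin.zero    = subst (E a) (sym (vertex-zero w)) e
  vertex-step (_ ∷⟨ _ ⟩ w) (Fin.suc i) = vertex-step w i

  vertex-injective : ∀ {a b} (w : Walk a b) → Simple w → Injective _≡_ _≡_ (vertex w)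
  vertex-injective [ _ ]        _            {Fin.zero}  {Fin.zero}  _  = refl
  vertex-injective (_ ∷⟨ _ ⟩ _) _            {Fin.zero}  {Fin.zero}  _  = refl
  vertex-injective (_ ∷⟨ _ ⟩ w) (a∉w , _)    {Fin.zero}  {Fin.suc j} eq =
    contradiction (subst (_∈ʷ w) (sym eq) (vertex-∈ʷ w j)) a∉w
  vertex-injective (_ ∷⟨ _ ⟩ w) (a∉w , _)    {Fin.suc i} {Fin.zero}  eq =
    contradiction (subst (_∈ʷ w) eq (vertex-∈ʷ w i)) a∉w
  vertex-injective (_ ∷⟨ _ ⟩ w) (_ , simple) {Fin.suc i} {Fin.suc j} eq =
    cong Fin.suc (vertex-injective w simple eq)

  toPath : ∀ {a b} (w : Walk a b) → Simple w → Path E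
  toPath w simple = record
    { len = steps w ; vtx = vertex w ; step = vertex-step w ; inj = vertex-injective w simple }

  cycle : DecidableEquality V → ∀ {a b c} → E a b → (w : Walk b c) → a ∉ʷ w → b ≢ c → E c a → HasCycle E
  cycle _≟_ {a} e w a∉w b≢c e′ with simplify _≟_ w
  ... | w′ , simple , w′⊆w =
    toPath (a ∷⟨ e ⟩ w′) (a∉w ∘ w′⊆w , simple) ,
    s≤s (1≤steps w′ b≢c) ,
    subst (λ x → E x a) (sym (vertex-last w′)) e′

  private
    walkAlong : ∀ l (f : Fin (suc l) → V) → (∀ i → E (f (inject₁ i)) (f (Fin.suc i))) →
                Walk (f Fin.zero) (f (fromℕ l))
    walkAlong zero    f _  = [ f Fin.zero ]
    walkAlong (suc l) f st = f Fin.zero ∷⟨ st Fin.zero ⟩ walkAlong l (f ∘ Fin.suc) (st ∘ Fin.suc)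

    steps-walkAlong : ∀ l f st → steps (walkAlong l f st) ≡ l
    steps-walkAlong zero    f st = refl
    steps-walkAlong (suc l) f st = cong suc (steps-walkAlong l (f ∘ Fin.suc) (st ∘ Fin.suc))

    ∈-walkAlong⁻ : ∀ l f st {x} → x ∈ʷ walkAlong l f st → ∃ λ i → f i ≡ x
    ∈-walkAlong⁻ zero    f st x≡        = Fin.zero , sym x≡
    ∈-walkAlong⁻ (suc l) f st (inj₁ x≡) = Fin.zero , sym x≡
    ∈-walkAlong⁻ (suc l) f st (inj₂ x∈) =
      let i , fi≡x = ∈-walkAlong⁻ l (f ∘ Fin.suc) (st ∘ Fin.suc) x∈ in Fin.suc i , fi≡x

  fromPathFromTo : ∀ {a b} → PathFromTo E a b → Walk a b
  fromPathFromTo (P , refl , refl) = walkAlong (len P) (vtx P) (step P)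

  steps-fromPathFromTo : ∀ {a b} (Q : PathFromTo E a b) → steps (fromPathFromTo Q) ≡ len (proj₁ Q)
  steps-fromPathFromTo (P , refl , refl) = steps-walkAlong (len P) (vtx P) (step P)

  ∈-fromPathFromTo⁻ : ∀ {a b x} (Q : PathFromTo E a b) → x ∈ʷ fromPathFromTo Q → _∈P (proj₁ Q) x
  ∈-fromPathFromTo⁻ (P , refl , refl) = ∈-walkAlong⁻ (len P) (vtx P) (step P)

  module _ {K : ℕ} (code : ∀ {a b} → E a b → Fin K)
           (code-injective : ∀ {a b b′} (e : E a b) (e′ : E a b′) → code e ≡ code e′ → b ≡ b′) where

    -- Digit 0 marks the end of a walk, so walks of different lengths get different codes.
    walkCode : ∀ L {a b} (w : Walk a b) → steps w ≤ L → Fin (suc K ^ L)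
    walkCode zero    [ _ ]        _         = Fin.zero
    walkCode (suc L) [ a ]        _         = combine {suc K} Fin.zero (walkCode L [ a ] z≤n)
    walkCode (suc L) (_ ∷⟨ e ⟩ w) (s≤s w≤L) = combine {suc K} (Fin.suc (code e)) (walkCode L w w≤L)

    walkCode-injective : ∀ L {a b b′} (w : Walk a b) (w′ : Walk a b′) w≤L w′≤L →
                         walkCode L w w≤L ≡ walkCode L w′ w′≤L → b ≡ b′
    walkCode-injective zero    [ _ ] [ _ ] _ _ _ = refl
    walkCode-injective (suc L) [ _ ] [ _ ] _ _ _ = refl
    walkCode-injective (suc L) [ _ ] (_ ∷⟨ e′ ⟩ _) _ (s≤s _) eq
      with () ← proj₁ (combine-injective Fin.zero _ (Fin.suc (code e′)) _ eq)
    walkCode-injective (suc L) (_ ∷⟨ e ⟩ _) [ _ ] (s≤s _) _ eq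
      with () ← proj₁ (combine-injective (Fin.suc (code e)) _ Fin.zero _ eq)
    walkCode-injective (suc L) (_ ∷⟨ e ⟩ w) (_ ∷⟨ e′ ⟩ w′) (s≤s w≤L) (s≤s w′≤L) eq
      with first≡ , rest≡ ← combine-injective (Fin.suc (code e)) _ (Fin.suc (code e′)) _ eq
      with refl ← code-injective e e′ (Fin.suc-injective first≡)
      = walkCode-injective L w w′ w≤L w′≤L rest≡

long-walk : ∀ {M K : ℕ} {E : Fin M → Fin M → Set} (code : ∀ {a b} → E a b → Fin K) →
            (∀ {a b b′} (e : E a b) (e′ : E a b′) → code e ≡ code e′ → b ≡ b′) →
            ∀ {r} (walk : ∀ t → Walks.Walk E r t) L → suc K ^ L < M → ∃ λ t → L < Walks.steps E (walk t)
long-walk {E = E} code code-injective walk L few with Fin.any? (λ t → L <? Walks.steps E (walk t))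
... | yes long = long
... | no ¬long = contradiction (Fin.injective⇒≤ injective) (<⇒≱ few)
  where
    open Walks E
    short : ∀ t → steps (walk t) ≤ L
    short t = ≮⇒≥ λ long → ¬long (t , long)
    injective : Injective _≡_ _≡_ (λ t → walkCode code code-injective L (walk t) (short t))
    injective {t} {t′} = walkCode-injective code code-injective L (walk t) (walk t′) (short t) (short t′)

-- Lean tree-decompositions of bounded-degree graphs

module BoundedDegree (G : MultiGraph)
                     {M : ℕ} {TAdj : Fin M → Fin M → Set} {Y : Fin M → Subset (MultiGraph.N G)}
                     (G-connected : Connected (MultiGraph.Adj G)) (tree : IsTree TAdj)
                     (lean : IsLeanTreeDecomposition G TAdj Y) where

  open MultiGraph G

  open IsTree tree using (acyclic; irrefl) renaming (sym to T-sym; connected to T-connected)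
  open IsLeanTreeDecomposition lean using (isTD; W5)
  open IsTreeDecomposition isTD using (W1-vertices; W1-edges; W2)
  module T = Walks TAdj
  module GW = Walks Adj

  InBranch : Fin M → Fin M → Fin N → Set
  InBranch u c x = ∃ λ t → x ∈ Y t × Σ (T.Walk c t) (u T.∉ʷ_)

  walk-avoiding : ∀ {t t′ u x} → x ∈ Y t → x ∈ Y t′ → x ∉ Y u → Σ (T.Walk t t′) (u T.∉ʷ_)
  walk-avoiding {t} {t′} {u} x∈t x∈t′ x∉u =
    T.fromPathFromTo Q , λ u∈ → x∉u (W2 t u t′ (Q , T.∈-fromPathFromTo⁻ Q u∈) _ x∈t x∈t′)
    where Q = T-connected t t′

  Joins : Fin m → Fin N → Fin N → Set
  Joins e x y = (ends e ≡ (x , y)) ⊎ (ends e ≡ (y , x))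

  joint-bag : ∀ {e x y} → Joins e x y → ∃ λ t → x ∈ Y t × y ∈ Y t
  joint-bag {e} joins with W1-edges e
  ... | t , end₁∈t , end₂∈t with joins
  ...   | inj₁ e≡xy = t , subst (_∈ Y t) (cong proj₁ e≡xy) end₁∈t , subst (_∈ Y t) (cong proj₂ e≡xy) end₂∈t
  ...   | inj₂ e≡yx = t , subst (_∈ Y t) (cong proj₂ e≡yx) end₂∈t , subst (_∈ Y t) (cong proj₁ e≡yx) end₁∈t

  other-end : ∀ {e x x′ y} → Joins e x y → Joins e x′ y → x ≡ x′
  other-end (inj₁ e≡xy) (inj₁ e≡x′y) = cong proj₁ (trans (sym e≡xy) e≡x′y)
  other-end (inj₂ e≡yx) (inj₂ e≡yx′) = cong proj₂ (trans (sym e≡yx) e≡yx′)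
  other-end {e} (inj₁ e≡xy) (inj₂ e≡yx′) =
    ⊥-elim (loopless e (trans (cong proj₁ e≡yx′) (sym (cong proj₂ e≡xy))))
  other-end {e} (inj₂ e≡yx) (inj₁ e≡x′y) =
    ⊥-elim (loopless e (trans (cong proj₁ e≡yx) (sym (cong proj₂ e≡x′y))))

  InBranch-step : ∀ {u c x x′} → InBranch u c x → x ∉ Y u → Adj x x′ → x′ ∉ Y u → InBranch u c x′
  InBranch-step (t , x∈t , w , u∉w) x∉u (_ , joins) x′∉u =
    let t′ , x∈t′ , x′∈t′ = joint-bag joins
        w′ , u∉w′ = walk-avoiding x∈t x∈t′ x∉u
    in t′ , x′∈t′ , w T.++ʷ w′ , T.∉-++ʷ w u∉w u∉w′

  InBranch-unique : ∀ {u c c′ x} → TAdj u c → TAdj u c′ →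
                    InBranch u c x → InBranch u c′ x → x ∉ Y u → c ≡ c′
  InBranch-unique {c = c} {c′} u~c u~c′ (t , x∈t , w , u∉w) (t′ , x∈t′ , w′ , u∉w′) x∉u
    with c Fin.≟ c′
  ... | yes c≡c′ = c≡c′
  ... | no  c≢c′ = ⊥-elim (acyclic (T.cycle Fin._≟_ u~c walk u∉walk c≢c′ (T-sym u~c′)))
    where
      middle = walk-avoiding x∈t x∈t′ x∉u
      walk = w T.++ʷ proj₁ middle T.++ʷ T.reverse T-sym w′
      u∉walk = T.∉-++ʷ w u∉w (T.∉-++ʷ (proj₁ middle) (proj₂ middle) (u∉w′ ∘ T.∈-reverse⁻ T-sym w′))

  record Exit (u c : Fin M) : Set where
    field
      inner outer : Fin N
      inner∈branch : InBranch u c inner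
      inner∉bag    : inner ∉ Y u
      outer∈bag    : outer ∈ Y u
      adjacent     : Adj inner outer

  leave : ∀ {u c x x′} → InBranch u c x → x ∉ Y u → GW.Walk x x′ →
          Exit u c ⊎ (InBranch u c x′ × x′ ∉ Y u)
  leave br x∉u GW.[ _ ] = inj₂ (br , x∉u)
  leave {u} br x∉u (GW._∷⟨_⟩_ x {y} x~y w) with y ∈? Y u
  ... | yes y∈u = inj₁ (record
    { inner∈branch = br ; inner∉bag = x∉u ; outer∈bag = y∈u ; adjacent = x~y })
  ... | no  y∉u = leave (InBranch-step br x∉u x~y y∉u) y∉u w

  branch-vertex : ∀ {u c} → TAdj u c → ∃ λ v → InBranch u c v × v ∉ Y u
  branch-vertex {u} {c} u~c with W5 u c (λ c≡u → irrefl (subst (TAdj u) c≡u u~c))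
  ... | t , (Q , u∉Q) , v , v∈t , v∉u =
    v , (t , v∈t , T.fromPathFromTo Q , u∉Q ∘ T.∈-fromPathFromTo⁻ Q) , v∉u

  G-walk : ∀ x y → GW.Walk x y
  G-walk x y = GW.fromPathFromTo (G-connected x y)

  exit : ∀ {u c z} → z ∈ Y u → TAdj u c → Exit u c
  exit {z = z} z∈u u~c with branch-vertex u~c
  ... | v , br , v∉u with leave br v∉u (G-walk v z)
  ...   | inj₁ ex        = ex
  ...   | inj₂ (_ , z∉u) = contradiction z∈u z∉u

  lonely-branch : ∀ {u c c′} → Empty (Y u) → TAdj u c → TAdj u c′ → c ≡ c′
  lonely-branch empty u~c u~c′ with branch-vertex u~c | branch-vertex u~c′
  ... | v , br , v∉u | v′ , br′ , v′∉u with leave br′ v′∉u (G-walk v′ v)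
  ...   | inj₁ ex         = contradiction (Exit.outer ex , Exit.outer∈bag ex) empty
  ...   | inj₂ (br′v , _) = InBranch-unique u~c u~c′ br br′v v∉u

  module _ {w d : ℕ} (width : WidthAtMost G Y w) (deg : MaxDegreeAtMost G d) where

    bag-elements : ∀ t → length (elements (Y t)) ≤ suc w
    bag-elements t = ≤-trans (≤-reflexive (length-elements (Y t))) (width t)

    vertex-count : N ≤ M * suc w
    vertex-count = Fin.injective⇒≤ λ {v} {v′} →
      code-injective (proj₂ (W1-vertices v)) (proj₂ (W1-vertices v′))
      where
        code : ∀ {v t} → v ∈ Y t → Fin (M * suc w)
        code {t = t} v∈t = combine t (indexIn (bag-elements t) (∈-elements v∈t))
        code-injective : ∀ {v v′ t t′} (v∈t : v ∈ Y t) (v′∈t′ : v′ ∈ Y t′) → code v∈t ≡ code v′∈t′ → v ≡ v′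
        code-injective {t = t} v∈t v′∈t′ eq with refl , index≡ ← combine-injective t _ _ _ eq =
          indexIn-injective (bag-elements t) _ _ index≡

    incidentEdges : Fin N → List (Fin m)
    incidentEdges y = filter (incident? y) (allFin m)

    ∈-incidentEdges : ∀ {e x y} → Joins e x y → e ∈ˡ incidentEdges y
    ∈-incidentEdges {e} joins =
      ∈-filter⁺ (incident? _) (∈-allFin e) (Sum.swap (Sum.map (cong proj₂) (cong proj₁) joins))

    edgeCode : ∀ {u x y} → y ∈ Y u → Adj x y → Fin (suc w * d)
    edgeCode {u} {y = y} y∈u (_ , joins) =
      combine (indexIn (bag-elements u) (∈-elements y∈u)) (indexIn (deg y) (∈-incidentEdges joins))

    edgeCode-injective : ∀ {u x x′ y y′} (y∈u : y ∈ Y u) (y′∈u : y′ ∈ Y u) (x~y : Adj x y) (x′~y′ : Adj x′ y′) →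
                         edgeCode y∈u x~y ≡ edgeCode y′∈u x′~y′ → x ≡ x′
    edgeCode-injective {u} {y = y} y∈u y′∈u (_ , joins) (_ , joins′) eq
      with outer≡ , edge≡ ← combine-injective (indexIn (bag-elements u) (∈-elements y∈u)) _ _ _ eq
      with refl ← indexIn-injective (bag-elements u) (∈-elements y∈u) (∈-elements y′∈u) outer≡
      with refl ← indexIn-injective (deg y) (∈-incidentEdges joins) (∈-incidentEdges joins′) edge≡
      = other-end joins joins′

    exitCode : ∀ {u c} → Exit u c → Fin (suc w * d)
    exitCode ex = edgeCode (Exit.outer∈bag ex) (Exit.adjacent ex)

    exit-injective : ∀ {u c c′} → TAdj u c → TAdj u c′ → (ex : Exit u c) (ex′ : Exit u c′) →
                     exitCode ex ≡ exitCode ex′ → c ≡ c′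
    exit-injective u~c u~c′ ex ex′ eq =
      InBranch-unique u~c u~c′ inner∈branch (subst (InBranch _ _) (sym same-inner) (Exit.inner∈branch ex′)) inner∉bag
      where
        open Exit ex
        same-inner = edgeCode-injective outer∈bag (Exit.outer∈bag ex′) adjacent (Exit.adjacent ex′) eq

    branchCodeWith : ∀ {u c} → Dec (Nonempty (Y u)) → TAdj u c → Fin (suc (suc w * d))
    branchCodeWith (yes (_ , z∈u)) u~c = Fin.suc (exitCode (exit z∈u u~c))
    branchCodeWith (no _) _ = Fin.zero

    branchCodeWith-injective : ∀ {u c c′} (dec : Dec (Nonempty (Y u))) (u~c : TAdj u c) (u~c′ : TAdj u c′) →
                               branchCodeWith dec u~c ≡ branchCodeWith dec u~c′ → c ≡ c′
    branchCodeWith-injective (yes (_ , z∈u)) u~c u~c′ eq =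
      exit-injective u~c u~c′ (exit z∈u u~c) (exit z∈u u~c′) (Fin.suc-injective eq)
    branchCodeWith-injective (no empty) u~c u~c′ _ = lonely-branch empty u~c u~c′

    branchCode : ∀ {u c} → TAdj u c → Fin (suc (suc w * d))
    branchCode {u} = branchCodeWith (nonempty? (Y u))

    branchCode-injective : ∀ {u c c′} (u~c : TAdj u c) (u~c′ : TAdj u c′) → branchCode u~c ≡ branchCode u~c′ → c ≡ c′
    branchCode-injective {u} = branchCodeWith-injective (nonempty? (Y u))

    long-path : ∀ L → suc (suc (suc w * d)) ^ L * suc w < N → ∃ λ (P : Path TAdj) → L < len P
    long-path L few-vertices =
      let t , long = long-walk branchCode branchCode-injective walk L many-nodes
      in proj₁ (T-connected root t) , subst (L <_) (T.steps-fromPathFromTo (T-connected root t)) long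
      where
        root = Fin.fromℕ< (IsTree.nonempty tree)
        walk = λ t → T.fromPathFromTo (T-connected root t)
        many-nodes = ≰⇒> λ M≤ → <⇒≱ few-vertices (≤-trans vertex-count (*-monoˡ-≤ (suc w) M≤))

-- Sunflowers along a path

windowLength : ℕ → ℕ → ℕ
windowLength n w = sunflowerBound n (suc w) (suc w) ^ suc (suc w)

module _ {N : ℕ} (bag : ℕ → Subset N) (n w : ℕ) where

  open Plateaus (∣_∣ ∘ bag)
  open Sunflowers bag n (suc w)

  positive-level : ∀ {s a b} ps → 2 ≤ length ps → Plateau s a b ps →
                   (∀ {k k′} → InWindow a b k → InWindow a b k′ → k < k′ → bag k ≢ bag k′) → 1 ≤ s
  positive-level (_ ∷ []) (s≤s ()) _ _
  positive-level (p ∷ q ∷ _) _ pl distinct with Plateau.sorted pl | Plateau.within pl | Plateau.level pl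
  ... | (p<q ∷ _) ∷ _ | p∈ ∷ q∈ ∷ _ | ∣p∣≡s ∷ ∣q∣≡s ∷ _ = n≢0⇒n>0 λ s≡0 →
    distinct p∈ q∈ p<q (trans (∣p∣≡0⇒p≡∅ (trans ∣p∣≡s s≡0)) (sym (∣p∣≡0⇒p≡∅ (trans ∣q∣≡s s≡0))))

  sunflower-plateau : 1 ≤ n → ∀ a → (∀ k → ∣ bag k ∣ ≤ suc w) →
    (∀ {k k′} → InWindow a (a + windowLength n w) k → InWindow a (a + windowLength n w) k′ →
                k < k′ → bag k ≢ bag k′) →
    ∃₂ λ s ps → 1 ≤ s × s ≤ suc w × Plateau s a (a + windowLength n w) ps ×
                ∃ λ U → n ≤ length ps × Kernel U ps
  sunflower-plateau 1≤n a width distinct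
    with plateau (sunflowerBound n (suc w) (suc w)) (suc w) 0 a (λ {k} _ → z≤n , width k)
  ... | s , ps , _ , s≤ , R≤ , pl with sunflower ps s≤ R≤ (Plateau.level pl)
  ...   | qs , U , τ , n≤qs , kernel =
    s , qs , positive-level ps (≤-trans 2≤R R≤) pl distinct , s≤ , Plateau-⊑ τ pl , U , n≤qs , kernel
    where 2≤R = s≤s (≤-trans 1≤n (≤-trans (n≤sunflowerBound n (suc w) w) (m≤m+n _ _)))

module _ {V : Set} {E : V → V → Set} {N : ℕ} (P : Path E) (Y : V → Subset N) where

  clamp : ℕ → Fin (suc (len P))
  clamp k = Fin.fromℕ< (s≤s (m⊓n≤n k (len P)))

  toℕ-clamp : ∀ {k} → k ≤ len P → toℕ (clamp k) ≡ k
  toℕ-clamp k≤ = trans (Fin.toℕ-fromℕ< _) (m≤n⇒m⊓n≡m k≤)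

  clamp-toℕ : ∀ i → clamp (toℕ i) ≡ i
  clamp-toℕ i = Fin.toℕ-injective (toℕ-clamp (Fin.toℕ≤pred[n] i))

  SunflowerAlong : ℕ → ℕ → Set
  SunflowerAlong n w = Σ (Fin n → Fin (suc (len P))) λ pos →
      (∀ i → (0 < toℕ (pos i)) × (toℕ (pos i) < len P)) ×
      (∀ i j → toℕ i < toℕ j → toℕ (pos i) < toℕ (pos j)) ×
      (∃[ s ] ((1 ≤ s) × (s ≤ suc w) ×
               (∀ i → ∣ Y (vtx P (pos i)) ∣ ≡ s) ×
               (∀ (k : Fin (suc (len P))) →
                  (∃[ i ] (toℕ (pos i) ≤ toℕ k)) → (∃[ j ] (toℕ k ≤ toℕ (pos j))) →
                  s ≤ ∣ Y (vtx P k) ∣))) ×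
      (∃[ U ] (∀ i j → i ≢ j → (Y (vtx P (pos i)) ∩ Y (vtx P (pos j))) ≡ U))

  private
    bag : ℕ → Subset N
    bag = Y ∘ vtx P ∘ clamp

    distinct-on : ∀ {a b k k′} → b ≤ len P → InWindow a b k → InWindow a b k′ →
                  Injective _≡_ _≡_ (Y ∘ vtx P) → k < k′ → bag k ≢ bag k′
    distinct-on {k = k} {k′} b≤ (_ , k<b) (_ , k′<b) distinct k<k′ eq = <-irrefl (begin
      k                 ≡⟨ toℕ-clamp (<⇒≤ (<-≤-trans k<b b≤)) ⟨
      toℕ (clamp k)     ≡⟨ cong toℕ (distinct eq) ⟩
      toℕ (clamp k′)    ≡⟨ toℕ-clamp (<⇒≤ (<-≤-trans k′<b b≤)) ⟩
      k′                ∎) k<k′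
      where open ≡-Reasoning

  sunflower-along : ∀ {n w} → 1 ≤ n → windowLength n w < len P → (∀ v → ∣ Y v ∣ ≤ suc w) →
                    Injective _≡_ _≡_ (Y ∘ vtx P) → SunflowerAlong n w
  sunflower-along {n} {w} 1≤n long width distinct
    with sunflower-plateau bag n w 1≤n 1 (width ∘ vtx P ∘ clamp) (λ k∈ k′∈ → distinct-on long k∈ k′∈ distinct)
  ... | s , ps , 1≤s , s≤ , pl , U , n≤ps , kernel =
    pos , interior , increasing , (s , 1≤s , s≤ , level , between) , (U , petals)
    where
      open Plateaus (∣_∣ ∘ bag) using (module Plateau)
      open Plateau pl using (sorted; within)

      q : Fin n → ℕ
      q = select ps n≤ps

      q-within : ∀ i → InWindow 1 (1 + windowLength n w) (q i)
      q-within i = All.lookup within (select-∈ ps n≤ps i)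

      pos : Fin n → Fin (suc (len P))
      pos = clamp ∘ q

      toℕ-pos : ∀ i → toℕ (pos i) ≡ q i
      toℕ-pos i = toℕ-clamp (<⇒≤ (<-≤-trans (proj₂ (q-within i)) long))

      interior : ∀ i → (0 < toℕ (pos i)) × (toℕ (pos i) < len P)
      interior i = subst (0 <_) (sym (toℕ-pos i)) (proj₁ (q-within i)) ,
                   subst (_< len P) (sym (toℕ-pos i)) (<-≤-trans (proj₂ (q-within i)) long)

      increasing : ∀ i j → toℕ i < toℕ j → toℕ (pos i) < toℕ (pos j)
      increasing i j i<j = subst₂ _<_ (sym (toℕ-pos i)) (sym (toℕ-pos j)) (AllPairs-select ps n≤ps sorted i<j)

      level : ∀ i → ∣ Y (vtx P (pos i)) ∣ ≡ s
      level i = All.lookup (Plateau.level pl) (select-∈ ps n≤ps i)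

      between : ∀ k → (∃ λ i → toℕ (pos i) ≤ toℕ k) → (∃ λ j → toℕ k ≤ toℕ (pos j)) → s ≤ ∣ Y (vtx P k) ∣
      between k (i , i≤k) (j , k≤j) =
        subst (λ k′ → s ≤ ∣ Y (vtx P k′) ∣) (clamp-toℕ k)
          (Plateau.between pl (select-∈ ps n≤ps i) (select-∈ ps n≤ps j)
            (subst (_≤ toℕ k) (toℕ-pos i) i≤k) (subst (toℕ k ≤_) (toℕ-pos j) k≤j))

      petals : ∀ i j → i ≢ j → Y (vtx P (pos i)) ∩ Y (vtx P (pos j)) ≡ U
      petals i j i≢j with Fin.<-cmp i j
      ... | tri< i<j _ _ = AllPairs-select ps n≤ps kernel i<j
      ... | tri≈ _ i≡j _ = contradiction i≡j i≢j
      ... | tri> _ _ j<i = trans (∩-comm (Y (vtx P (pos i))) _) (AllPairs-select ps n≤ps kernel j<i)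

lemma6p4 : Σ (ℕ → ℕ → ℕ → ℕ) λ f →
    ∀ (n w d : ℕ) → 1 ≤ n → 1 ≤ w → 1 ≤ d →
    ∀ (G : MultiGraph) → Connected (MultiGraph.Adj G) → MaxDegreeAtMost G d →
    ∀ (M : ℕ) (TAdj : Fin M → Fin M → Set) (Y : Fin M → Subset (MultiGraph.N G)) →
    IsTree TAdj → IsLeanTreeDecomposition G TAdj Y → WidthAtMost G Y w →
    f n w d ≤ MultiGraph.N G →
    Σ (Path TAdj) λ P → Σ (Fin n → Fin (suc (len P))) λ pos →
      -- t_i = vtx P (pos i) are interior vertices of P, in this order
      (∀ i → (0 < toℕ (pos i)) × (toℕ (pos i) < len P)) ×
      (∀ i j → toℕ i < toℕ j → toℕ (pos i) < toℕ (pos j)) ×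
      -- (i)
      (∃[ s ] ((1 ≤ s) × (s ≤ suc w) ×
               (∀ i → ∣ Y (vtx P (pos i)) ∣ ≡ s) ×
               (∀ (k : Fin (suc (len P))) →
                  (∃[ i ] (toℕ (pos i) ≤ toℕ k)) → (∃[ j ] (toℕ k ≤ toℕ (pos j))) →
                  s ≤ ∣ Y (vtx P k) ∣))) ×
      -- (ii)
      (∃[ U ] (∀ i j → i ≢ j → (Y (vtx P (pos i)) ∩ Y (vtx P (pos j))) ≡ U))
lemma6p4 = bound , λ n w d 1≤n _ _ G G-connected deg M TAdj Y tree lean width big →
  let open BoundedDegree G G-connected tree lean
      P , long = long-path width deg (windowLength n w) big
  in P , sunflower-along P Y 1≤n long width (inj P ∘ IsLeanTreeDecomposition.W4 lean)
  where
    bound : ℕ → ℕ → ℕ → ℕ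
    bound n w d = suc (suc (suc (suc w * d)) ^ windowLength n w * suc w)
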